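{- Let $G=(L,R,E)$ be a bipartite graph with $L=\{1,\dots,k\}$, $k\ge2$, $n_R=|R|$, and let $t\le k$ be a positive integer. Let $H$ be the complete bipartite graph with parts $L$ and $B=\{b_1,\dots,b_t\}$ (a new set of $t$ vertices), all edges having unit weight, with terminal set $L$ (vertex $i$ being the $i$-th terminal), and define for $x\in\mathbb{R}^k$: $\|x\|=\sum_{v\in R}\max_{i\in N(v)}|x_i|$. Let $(P_i)_{i\in L}$ be a partition of $V(H)$ with $i\in P_i$ for every $i\in L$, and let $c=\|(\delta(P_1),\dots,\delta(P_k))\|$ be its cost. Define $y\in\mathbb{R}^L$ by $y_i=|P_i|-1$. Then $$(k-2)\|y\|\le c\le (k-2)\|y\|+t\,n_R.$$
   Context: $N(v)$ denotes the set of neighbors of $v$ in $G$. $\delta(S)$ is the number of edges of $H$ with exactly one endpoint in $S$. -}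

module Defs where

open import Data.Nat using (ℕ; zero; suc; _+_; _∸_; _⊔_)
open import Data.Bool using (Bool; true; false; if_then_else_; _xor_)
open import Data.Fin using (Fin; zero; suc; _≟_)
open import Data.Sum using (_⊎_; inj₁; inj₂)
open import Data.List using (List; filterᵇ; foldr; map)
open import Data.List using () renaming (allFin to allFinL)
open import Relation.Nullary.Decidable using (⌊_⌋)

sumFin : ∀ {n} → (Fin n → ℕ) → ℕ
sumFin {zero} g = 0
sumFin {suc n} g = g zero + sumFin (λ i → g (suc i))

count : ∀ {n} → (Fin n → Bool) → ℕ
count p = sumFin (λ i → if p i then 1 else 0)

maxList : List ℕ → ℕ
maxList = foldr _⊔_ 0

-- Bipartite graph G = (L, R, E) with L = Fin k, R = Fin nR,
-- E v i = true iff v ∈ R is adjacent to i ∈ L.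
-- N(v) : neighbours of v ∈ R (in L)
N : ∀ {k nR} → (Fin nR → Fin k → Bool) → Fin nR → List (Fin k)
N E v = filterᵇ (E v) (allFinL _)

-- ‖x‖ = Σ_{v∈R} max_{i∈N(v)} |x_i|   (all vectors here are ℕ-valued, so |x_i| = x_i)
norm : ∀ {k nR} → (Fin nR → Fin k → Bool) → (Fin k → ℕ) → ℕ
norm E x = sumFin (λ v → maxList (map x (N E v)))

-- H : complete bipartite graph on V(H) = L ⊎ B, L = Fin k, B = Fin t,
-- edges = all pairs (a , b) with a ∈ L, b ∈ B, unit weights.
VH : ℕ → ℕ → Set
VH k t = Fin k ⊎ Fin t

-- A partition (P_i)_{i∈L} of V(H) is given by its part-assignment f : V(H) → L;
-- P_i = { u | f u ≡ i }.
inP : ∀ {k t} → (VH k t → Fin k) → Fin k → VH k t → Bool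
inP f i u = ⌊ f u ≟ i ⌋

size : ∀ {k t} → (VH k t → Fin k) → Fin k → ℕ
size {k} {t} f i = count (λ a → inP f i (inj₁ a)) + count (λ b → inP f i (inj₂ b))

δ : ∀ {k t} → (VH k t → Fin k) → Fin k → ℕ
δ f i = sumFin (λ a → count (λ b → inP f i (inj₁ a) xor inP f i (inj₂ b)))

yvec : ∀ {k t} → (VH k t → Fin k) → Fin k → ℕ
yvec f i = size f i ∸ 1

cost : ∀ {k nR t} → (Fin nR → Fin k → Bool) → (VH k t → Fin k) → ℕ
cost E f = norm E (δ f)

{-# OPTIONS --safe #-}
module Submission where

-- Since P i meets L exactly in {i}, write s = |P i ∩ B| = y i. The edges leaving P i
-- are those from i to B ∖ P i (t − s of them) and those from the other k − 1 vertices
-- of L to P i ∩ B ((k − 1) s of them), so δ(P i) = t + (k − 2) y i. The norm is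
-- monotone and positively homogeneous, and adding the constant t to every coordinate
-- raises it by at most t per vertex of R.

open import Defs
open import Data.Nat using (ℕ; zero; suc; _+_; _*_; _∸_; _≤_; _⊔_; z≤n; s≤s)
open import Data.Nat.Properties
  using ( +-assoc; +-comm; +-suc; +-mono-≤; +-monoʳ-≤; *-comm; *-zeroʳ; *-distribˡ-+
        ; *-distribˡ-⊔; ⊔-mono-≤; ⊔-lub; m≤m⊔n; m≤n⊔m; m≤n+m; ≤-trans; ≤-reflexive
        ; module ≤-Reasoning)
open import Data.Bool using (Bool; true; false; if_then_else_; not; _xor_)
open import Data.Fin using (Fin; zero; suc; _≟_)
open import Data.Fin.Properties using (suc-injective)
open import Data.Sum using (inj₁; inj₂)
open import Data.Product using (_×_; _,_)
open import Data.List using (List; []; _∷_; map)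
open import Relation.Nullary.Decidable using (⌊_⌋; ⌊⌋-map′)
open import Relation.Binary.PropositionalEquality
  using (_≡_; refl; sym; trans; cong; cong₂; module ≡-Reasoning)

sumFin-cong : ∀ {n} {g h : Fin n → ℕ} → (∀ i → g i ≡ h i) → sumFin g ≡ sumFin h
sumFin-cong {zero}  g≡h = refl
sumFin-cong {suc n} g≡h = cong₂ _+_ (g≡h zero) (sumFin-cong (λ i → g≡h (suc i)))

sumFin-mono-≤ : ∀ {n} {g h : Fin n → ℕ} → (∀ i → g i ≤ h i) → sumFin g ≤ sumFin h
sumFin-mono-≤ {zero}  g≤h = z≤n
sumFin-mono-≤ {suc n} g≤h = +-mono-≤ (g≤h zero) (sumFin-mono-≤ (λ i → g≤h (suc i)))

sumFin-const : ∀ n c → sumFin {n} (λ _ → c) ≡ n * c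
sumFin-const zero    c = refl
sumFin-const (suc n) c = cong (c +_) (sumFin-const n c)

sumFin-*ˡ : ∀ {n} c (g : Fin n → ℕ) → sumFin (λ i → c * g i) ≡ c * sumFin g
sumFin-*ˡ {zero}  c g = sym (*-zeroʳ c)
sumFin-*ˡ {suc n} c g = trans (cong (c * g zero +_) (sumFin-*ˡ c (λ i → g (suc i))))
                              (sym (*-distribˡ-+ c (g zero) _))

sumFin-+ : ∀ {n} (g h : Fin n → ℕ) → sumFin (λ i → g i + h i) ≡ sumFin g + sumFin h
sumFin-+ {zero}  g h = refl
sumFin-+ {suc n} g h = begin
  (g zero + h zero) + sumFin (λ i → g (suc i) + h (suc i))
    ≡⟨ cong ((g zero + h zero) +_) (sumFin-+ (λ i → g (suc i)) (λ i → h (suc i))) ⟩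
  (g zero + h zero) + (G + H)    ≡⟨ +-assoc (g zero) (h zero) (G + H) ⟩
  g zero + (h zero + (G + H))    ≡⟨ cong (g zero +_) (sym (+-assoc (h zero) G H)) ⟩
  g zero + ((h zero + G) + H)    ≡⟨ cong (λ z → g zero + (z + H)) (+-comm (h zero) G) ⟩
  g zero + ((G + h zero) + H)    ≡⟨ cong (g zero +_) (+-assoc G (h zero) H) ⟩
  g zero + (G + (h zero + H))    ≡⟨ sym (+-assoc (g zero) G (h zero + H)) ⟩
  (g zero + G) + (h zero + H)    ∎
  where
  open ≡-Reasoning
  G = sumFin (λ i → g (suc i))
  H = sumFin (λ i → h (suc i))

sumFin-≟ : ∀ {n} (i : Fin (suc n)) (h : Bool → ℕ) →
           sumFin (λ a → h ⌊ a ≟ i ⌋) ≡ h true + n * h false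
sumFin-≟ {n} zero h = cong (h true +_) (sumFin-const n (h false))
sumFin-≟ {suc n} (suc j) h = begin
  h false + sumFin (λ a → h ⌊ suc a ≟ suc j ⌋)
    ≡⟨ cong (h false +_) (sumFin-cong (λ a → cong h (⌊⌋-map′ (cong suc) suc-injective (a ≟ j)))) ⟩
  h false + sumFin (λ a → h ⌊ a ≟ j ⌋)   ≡⟨ cong (h false +_) (sumFin-≟ j h) ⟩
  h false + (h true + n * h false)       ≡⟨ sym (+-assoc (h false) (h true) _) ⟩
  (h false + h true) + n * h false       ≡⟨ cong (_+ n * h false) (+-comm (h false) (h true)) ⟩
  (h true + h false) + n * h false       ≡⟨ +-assoc (h true) (h false) _ ⟩
  h true + (h false + n * h false)       ∎
  where open ≡-Reasoning

count-not : ∀ {n} (p : Fin n → Bool) → count (λ i → not (p i)) + count p ≡ n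
count-not {zero}  p = refl
count-not {suc n} p with p zero
... | true  = trans (+-suc _ _) (cong suc (count-not (λ i → p (suc i))))
... | false = cong suc (count-not (λ i → p (suc i)))

maxList-mono-≤ : ∀ {A : Set} {g h : A → ℕ} (xs : List A) → (∀ x → g x ≤ h x) →
                 maxList (map g xs) ≤ maxList (map h xs)
maxList-mono-≤ []       g≤h = z≤n
maxList-mono-≤ (x ∷ xs) g≤h = ⊔-mono-≤ (g≤h x) (maxList-mono-≤ xs g≤h)

maxList-*ˡ : ∀ {A : Set} c (g : A → ℕ) (xs : List A) →
             maxList (map (λ x → c * g x) xs) ≡ c * maxList (map g xs)
maxList-*ˡ c g []       = sym (*-zeroʳ c)
maxList-*ˡ c g (x ∷ xs) = trans (cong (c * g x ⊔_) (maxList-*ˡ c g xs))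
                                (sym (*-distribˡ-⊔ c (g x) _))

-- Only an inequality: the empty maximum is 0, not c + 0.
maxList-+ˡ-≤ : ∀ {A : Set} c (g : A → ℕ) (xs : List A) →
               maxList (map (λ x → c + g x) xs) ≤ c + maxList (map g xs)
maxList-+ˡ-≤ c g []       = z≤n
maxList-+ˡ-≤ c g (x ∷ xs) =
  ⊔-lub (+-monoʳ-≤ c (m≤m⊔n (g x) _))
        (≤-trans (maxList-+ˡ-≤ c g xs) (+-monoʳ-≤ c (m≤n⊔m (g x) _)))

module _ {k nR : ℕ} (E : Fin nR → Fin k → Bool) where

  norm-mono-≤ : {x z : Fin k → ℕ} → (∀ i → x i ≤ z i) → norm E x ≤ norm E z
  norm-mono-≤ x≤z = sumFin-mono-≤ (λ v → maxList-mono-≤ (N E v) x≤z)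

  norm-*ˡ : ∀ c (x : Fin k → ℕ) → norm E (λ i → c * x i) ≡ c * norm E x
  norm-*ˡ c x = trans (sumFin-cong (λ v → maxList-*ˡ c x (N E v)))
                      (sumFin-*ˡ c (λ v → maxList (map x (N E v))))

  norm-+ˡ-≤ : ∀ c (x : Fin k → ℕ) → norm E (λ i → c + x i) ≤ c * nR + norm E x
  norm-+ˡ-≤ c x = begin
    norm E (λ i → c + x i)
      ≤⟨ sumFin-mono-≤ (λ v → maxList-+ˡ-≤ c x (N E v)) ⟩
    sumFin (λ v → c + maxList (map x (N E v)))
      ≡⟨ sumFin-+ (λ _ → c) (λ v → maxList (map x (N E v))) ⟩
    sumFin {nR} (λ _ → c) + norm E x
      ≡⟨ cong (_+ norm E x) (trans (sumFin-const nR c) (*-comm nR c)) ⟩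
    c * nR + norm E x ∎
    where open ≤-Reasoning

module _ {m t : ℕ} (f : VH (suc (suc m)) t → Fin (suc (suc m)))
         (f-inj₁ : ∀ i → f (inj₁ i) ≡ i) (i : Fin (suc (suc m))) where

  private
    inB : Fin t → Bool
    inB b = inP f i (inj₂ b)

    sumFin-inj₁ : (h : Bool → ℕ) →
                  sumFin (λ a → h (inP f i (inj₁ a))) ≡ h true + suc m * h false
    sumFin-inj₁ h = trans (sumFin-cong (λ a → cong (λ j → h ⌊ j ≟ i ⌋) (f-inj₁ a)))
                          (sumFin-≟ i h)

  yvec-≡-count-inB : yvec f i ≡ count inB
  yvec-≡-count-inB = cong (λ n → n + count inB ∸ 1) (begin
    count (λ a → inP f i (inj₁ a)) ≡⟨ sumFin-inj₁ (λ b → if b then 1 else 0) ⟩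
    1 + suc m * 0                  ≡⟨ cong suc (*-zeroʳ (suc m)) ⟩
    1                              ∎)
    where open ≡-Reasoning

  δ-≡ : δ f i ≡ t + m * yvec f i
  δ-≡ = begin
    δ f i                    ≡⟨ sumFin-inj₁ (λ b → count (λ c → b xor inB c)) ⟩
    s̄ + (s + m * s)          ≡⟨ sym (+-assoc s̄ s (m * s)) ⟩
    (s̄ + s) + m * s          ≡⟨ cong (_+ m * s) (count-not inB) ⟩
    t + m * s                ≡⟨ cong (λ z → t + m * z) (sym yvec-≡-count-inB) ⟩
    t + m * yvec f i         ∎
    where
    open ≡-Reasoning
    s  = count inB
    s̄ = count (λ c → not (inB c))

claim6 : (k nR t : ℕ) → 2 ≤ k → 1 ≤ t → t ≤ k →
         (E : Fin nR → Fin k → Bool) →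
         (f : VH k t → Fin k) → (∀ i → f (inj₁ i) ≡ i) →
         ((k ∸ 2) * norm E (yvec f) ≤ cost E f)
         × (cost E f ≤ (k ∸ 2) * norm E (yvec f) + t * nR)
claim6 (suc (suc m)) nR t (s≤s (s≤s z≤n)) _ _ E f f-inj₁ = lower , upper
  where
  open ≤-Reasoning
  y = yvec f

  lower : m * norm E y ≤ cost E f
  lower = begin
    m * norm E y               ≡⟨ sym (norm-*ˡ E m y) ⟩
    norm E (λ i → m * y i)     ≤⟨ norm-mono-≤ E (λ i → ≤-trans (m≤n+m (m * y i) t)
                                                      (≤-reflexive (sym (δ-≡ f f-inj₁ i)))) ⟩
    cost E f                   ∎

  upper : cost E f ≤ m * norm E y + t * nR
  upper = begin
    cost E f                    ≤⟨ norm-mono-≤ E (λ i → ≤-reflexive (δ-≡ f f-inj₁ i)) ⟩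
    norm E (λ i → t + m * y i)  ≤⟨ norm-+ˡ-≤ E t (λ i → m * y i) ⟩
    t * nR + norm E (λ i → m * y i) ≡⟨ cong (t * nR +_) (norm-*ˡ E m y) ⟩
    t * nR + m * norm E y       ≡⟨ +-comm (t * nR) _ ⟩
    m * norm E y + t * nR       ∎
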